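{- Let $G$ be a finite group. Then $\eta(G)\le \mathsf s(G)-\mathsf e(G)+1$.
   Context: Groups are written multiplicatively with identity $1$. A sequence over $G$ is a finite unordered list of elements of $G$ with repetition allowed; its length $|S|$ is the number of terms. A sequence $S=a_1\cdot\ldots\cdot a_k$ is product-one if $1=a_{\tau(1)}\cdots a_{\tau(k)}$ for some permutation $\tau$ of $\{1,\dots,k\}$. Let $\mathsf e(G)=\max\{\mathrm{ord}(g):g\in G\}$. $\mathsf s(G)$ is the smallest $l$ such that every sequence over $G$ of length at least $l$ has a product-one subsequence of length exactly $\mathsf e(G)$; $\eta(G)$ is the smallest $l$ such that every sequence over $G$ of length at least $l$ has a product-one subsequence $T$ with $1\le |T|\le \mathsf e(G)$. -}

module Defs where

open import Level using (Level; _⊔_)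
open import Algebra.Bundles using (Group)
open import Data.Nat using (ℕ; zero; suc; _≤_; _<_)
open import Data.Fin using (Fin)
open import Data.List using (List; foldr; length)
open import Data.List.Relation.Binary.Sublist.Propositional using (_⊆_)
open import Data.List.Relation.Binary.Permutation.Propositional using (_↭_)
open import Data.Product using (Σ; ∃; _×_)
open import Function.Bundles using (Surjection)
open import Relation.Binary.PropositionalEquality using (_≡_; setoid)
open import Relation.Nullary using (¬_)

IsFiniteGroup : ∀ {c ℓ} → Group c ℓ → Set (c ⊔ ℓ)
IsFiniteGroup G = Σ ℕ λ n → Surjection (setoid (Fin n)) (Group.setoid G)

module _ {c ℓ} (G : Group c ℓ) where
  open Group G renaming (Carrier to A)

  pow : A → ℕ → A
  pow g zero    = ε
  pow g (suc k) = g ∙ pow g k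

  HasOrder : A → ℕ → Set ℓ
  HasOrder g k = (1 ≤ k) × (pow g k ≈ ε) × (∀ j → 1 ≤ j → j < k → ¬ (pow g j ≈ ε))

  IsExponentMax : ℕ → Set (c ⊔ ℓ)
  IsExponentMax e = (∃ λ g → HasOrder g e) × (∀ g k → HasOrder g k → k ≤ e)

  -- Sequences over G are lists (order irrelevant); the product of a list.
  prod : List A → A
  prod = foldr _∙_ ε

  ProductOne : List A → Set (c ⊔ ℓ)
  ProductOne T = ∃ λ T′ → (T ↭ T′) × (prod T′ ≈ ε)

  SProp : ℕ → ℕ → Set (c ⊔ ℓ)
  SProp e l = ∀ (S : List A) → l ≤ length S →
              ∃ λ T → (T ⊆ S) × (length T ≡ e) × ProductOne T

  EtaProp : ℕ → ℕ → Set (c ⊔ ℓ)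
  EtaProp e l = ∀ (S : List A) → l ≤ length S →
                ∃ λ T → (T ⊆ S) × (1 ≤ length T) × (length T ≤ e) × ProductOne T

  IsLeast : ∀ {p} → (ℕ → Set p) → ℕ → Set p
  IsLeast P l = P l × (∀ m → P m → l ≤ m)

module Submission where

-- Let e = e(G) ≥ 1 and let S be a sequence of length at least
-- s(G) − e + 1.  Padding S with e − 1 copies of the identity gives a sequence
-- of length at least s(G), which therefore contains a product-one subsequence
-- T of length exactly e.  Up to reordering, T consists of j ≤ e − 1 of the
-- padding identities followed by a subsequence T′ of S.  Deleting identities
-- keeps a sequence product-one, so T′ is product-one, and 1 ≤ |T′| = e − j ≤ e.
-- Hence s(G) − e + 1 has the η-property and minimality of η(G) gives the bound.

open import Defs
open import Algebra.Bundles using (Group)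
open import Data.Nat using (ℕ; _≤_; _+_; _∸_; zero; suc; z≤n; s≤s)
open import Data.Nat.Properties
  using (≤-trans; ≤-reflexive; m≤n⇒m≤1+n; m≤n+m; m≤n+m∸n; +-suc; +-comm; +-identityʳ;
         +-monoʳ-≤; <-irrefl; module ≤-Reasoning)
open import Data.List using (List; []; _∷_; _++_; replicate; length; [_])
open import Data.List.Properties using (length-++; length-replicate)
open import Data.List.Relation.Binary.Sublist.Propositional using (_⊆_; _∷_; _∷ʳ_)
open import Data.List.Relation.Binary.Permutation.Propositional
  using (_↭_; prep; ↭-sym; ↭-trans; ↭-refl)
open import Data.List.Relation.Binary.Permutation.Propositional.Properties
  using (∈-resp-↭; shift; drop-∷; ↭-length)
open import Data.List.Membership.Propositional.Properties using (∈-∃++)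
open import Data.List.Relation.Unary.Any using (here)
open import Data.Product using (∃; _×_; _,_)
open import Data.Empty using (⊥-elim)
open import Relation.Binary.PropositionalEquality using (_≡_; refl; cong; sym; trans; subst)

module ProductOneSequences {c ℓ} (G : Group c ℓ) where
  open Group G renaming (Carrier to A; refl to ≈-refl; sym to ≈-sym; trans to ≈-trans)

  ones : ℕ → List A
  ones k = replicate k ε

  prod-drop-ε : ∀ (xs ys : List A) → prod G (xs ++ [ ε ] ++ ys) ≈ prod G (xs ++ ys)
  prod-drop-ε []       ys = identityˡ _
  prod-drop-ε (x ∷ xs) ys = ∙-congˡ (prod-drop-ε xs ys)

  ProductOne-resp-↭ : ∀ {T U : List A} → T ↭ U → ProductOne G T → ProductOne G U
  ProductOne-resp-↭ T↭U (T′ , T↭T′ , prod≈ε) = T′ , ↭-trans (↭-sym T↭U) T↭T′ , prod≈ε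

  -- Removing one identity term keeps a sequence product-one: the identity
  -- sits somewhere in the product-one ordering and can be cut out of it.
  ProductOne-drop-ε : ∀ (R : List A) → ProductOne G (ε ∷ R) → ProductOne G R
  ProductOne-drop-ε R (T′ , ε∷R↭T′ , prod≈ε)
    with ∈-∃++ (∈-resp-↭ ε∷R↭T′ (here refl))
  ... | xs , ys , refl =
    xs ++ ys , drop-∷ (↭-trans ε∷R↭T′ (shift ε xs ys)) , ≈-trans (≈-sym (prod-drop-ε xs ys)) prod≈ε

  ProductOne-drop-ones : ∀ j (R : List A) → ProductOne G (ones j ++ R) → ProductOne G R
  ProductOne-drop-ones zero    R p = p
  ProductOne-drop-ones (suc j) R p = ProductOne-drop-ones j R (ProductOne-drop-ε _ p)

  split-padded : ∀ k {S T : List A} → T ⊆ ones k ++ S →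
                 ∃ λ j → ∃ λ T′ → (j ≤ k) × (T′ ⊆ S) × (T ↭ ones j ++ T′)
  split-padded zero    T⊆S = 0 , _ , z≤n , T⊆S , ↭-refl
  split-padded (suc k) (_ ∷ʳ T⊆) with split-padded k T⊆
  ... | j , T′ , j≤k , T′⊆S , T↭ = j , T′ , m≤n⇒m≤1+n j≤k , T′⊆S , T↭
  split-padded (suc k) (refl ∷ T⊆) with split-padded k T⊆
  ... | j , T′ , j≤k , T′⊆S , T↭ = suc j , T′ , s≤s j≤k , T′⊆S , prep ε T↭

remainder-bounds : ∀ {e j m} → j ≤ e → suc e ≡ j + m → 1 ≤ m × m ≤ suc e
remainder-bounds {j = j} {m = zero}  j≤e eq =
  ⊥-elim (<-irrefl refl (≤-trans (≤-reflexive (trans eq (+-identityʳ j))) j≤e))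
remainder-bounds {j = j} {m = suc m} j≤e eq = s≤s z≤n , subst (suc m ≤_) (sym eq) (m≤n+m (suc m) j)

padded-length : ∀ e s n → (s ∸ suc e) + 1 ≤ n → s ≤ e + n
padded-length e s n len = begin
  s                         ≤⟨ m≤n+m∸n s (suc e) ⟩
  suc e + (s ∸ suc e)       ≡⟨ +-suc e (s ∸ suc e) ⟨
  e + suc (s ∸ suc e)       ≡⟨ cong (e +_) (+-comm 1 (s ∸ suc e)) ⟩
  e + ((s ∸ suc e) + 1)     ≤⟨ +-monoʳ-≤ e len ⟩
  e + n                     ∎
  where open ≤-Reasoning

module Transfer {c ℓ} (G : Group c ℓ) where
  open ProductOneSequences G

  length-ones++ : ∀ k (S : List (Group.Carrier G)) → length (ones k ++ S) ≡ k + length S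
  length-ones++ k S = trans (length-++ (ones k)) (cong (_+ length S) (length-replicate k))

  -- The core transfer: if every sequence of length ≥ s has a product-one
  -- subsequence of length exactly e ≥ 1, then every sequence of length
  -- ≥ s − e + 1 has a product-one subsequence of length between 1 and e.
  -- (Here e + 1 plays the role of e.)  Pad with e identities, take the
  -- product-one subsequence of length e + 1, and strip the identities.
  SProp⇒EtaProp : ∀ (e s : ℕ) → SProp G (suc e) s → EtaProp G (suc e) ((s ∸ suc e) + 1)
  SProp⇒EtaProp e s sProp S len
    with sProp (ones e ++ S)
               (subst (s ≤_) (sym (length-ones++ e S)) (padded-length e s (length S) len))
  ... | T , T⊆ , |T|≡1+e , T-one with split-padded e T⊆
  ... | j , T′ , j≤e , T′⊆S , T↭ with remainder-bounds j≤e |T|-split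
    where
    |T|-split : suc e ≡ j + length T′
    |T|-split = trans (sym |T|≡1+e) (trans (↭-length T↭) (length-ones++ j T′))
  ... | 1≤|T′| , |T′|≤1+e =
    T′ , T′⊆S , 1≤|T′| , |T′|≤1+e , ProductOne-drop-ones j T′ (ProductOne-resp-↭ T↭ T-one)

open Transfer using (SProp⇒EtaProp)

-- Lemma 2.1: η(G) ≤ s(G) − e(G) + 1.  Elements have positive order, so
-- e(G) ≥ 1, and the transfer shows s(G) − e(G) + 1 has the η-property.
lemma2p1 : ∀ {c ℓ} (G : Group c ℓ) → IsFiniteGroup G →
    ∀ (e s η : ℕ) →
    IsExponentMax G e →
    IsLeast G (SProp G e) s →
    IsLeast G (EtaProp G e) η →
    η ≤ (s ∸ e) + 1
lemma2p1 G _ zero    s η ((_ , () , _) , _) _ _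
lemma2p1 G _ (suc e) s η _ (sProp , _) (_ , η-least) = η-least _ (SProp⇒EtaProp G e s sProp)
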